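{- Let $m\ge 2$. An $m$-Hadamardesque matrix has pairwise orthogonal rows if and only if its Column Representation Vector lies in the linear span of $RC_m$.
   Context: Sylvester Hadamard matrices: $H_2=\begin{bmatrix}1&1\\1&-1\end{bmatrix}$, $H_{2^k}=\begin{bmatrix}H_{2^{k-1}}&H_{2^{k-1}}\\ H_{2^{k-1}}&-H_{2^{k-1}}\end{bmatrix}$ for $k\ge2$. The matrices $T_m$ ($m\times 2^{m-1}$) are defined recursively by $T_1=[1]$ and $T_{m+1}=\begin{bmatrix} T_m & T_m\\ 1\cdots 1 & -1\cdots -1\end{bmatrix}$ (last row: $2^{m-1}$ ones then $2^{m-1}$ minus ones); its columns $c_1,\dots,c_{2^{m-1}}$ are all vectors $(1,\pm1,\dots,\pm1)\in\mathbb{R}^m$. For $w\in\mathbb{R}^m$, its Column Pairwise Product is $w'=(w_1w_2,w_1w_3,w_2w_3,w_1w_4,\dots,w_{m-1}w_m)\in\mathbb{R}^{m(m-1)/2}$ (for $i<j$, $w_iw_j$ in position $\frac{(j-1)(j-2)}{2}+i$). $CT_m$ is the $\frac{m(m-1)}{2}\times 2^{m-1}$ matrix whose $k$-th column is the Column Pairwise Product of $c_k$; each of its rows is a row of $H_{2^{m-1}}$. $R_m$ denotes the set of rows of $CT_m$, and $RC_m$ denotes the set of rows of $H_{2^{m-1}}$ that are not in $R_m$. An $m\times n$ real matrix $M$ is $m$-Hadamardesque if each of its columns equals $p\,c_k$ for some $p>0$ and some column $c_k$ of $T_m$. If the $l$-th column of $M$ is $p_l c_{k(l)}$, the Column Representation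 Vector of $M$ is $v\in\mathbb{R}^{2^{m-1}}$ with $v_k=\sum_{l:\,k(l)=k}p_l^2$ (and $0$ if no column of $M$ is a multiple of $c_k$). -}

module Defs where

open import Level using (Level; _⊔_) renaming (suc to lsuc)
open import Algebra.Bundles using (CommutativeRing)
open import Relation.Binary.Core using (Rel)
open import Relation.Binary.Structures using (IsStrictTotalOrder)
open import Relation.Binary.PropositionalEquality using (_≡_; _≢_; sym)
open import Relation.Nullary using (¬_; yes; no)
open import Data.Nat as ℕ using (ℕ; zero; suc; _^_; _∸_)
open import Data.Fin using (Fin; zero; suc; toℕ; remQuot; lower₁; _<_; _≟_)
open import Data.Bool using (Bool; true; false; if_then_else_; _xor_; _∧_)
open import Data.Product using (∃; _×_; proj₁; proj₂; _,_)
open import Function using (_∘_)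

-- Ordered fields (the paper works over ℝ; we work over an arbitrary
-- ordered field, which includes ℝ).

record OrderedField (c ℓ₁ ℓ₂ : Level) : Set (lsuc (c ⊔ ℓ₁ ⊔ ℓ₂)) where
  field
    commutativeRing : CommutativeRing c ℓ₁
  open CommutativeRing commutativeRing public
  field
    _<F_               : Rel Carrier ℓ₂
    isStrictTotalOrder : IsStrictTotalOrder _≈_ _<F_
    +-mono-<           : ∀ {x y} z → x <F y → (x + z) <F (y + z)
    *-pos              : ∀ {x y} → 0# <F x → 0# <F y → 0# <F (x * y)
    0≉1                : ¬ (0# ≈ 1#)
    inverse            : ∀ x → ¬ (x ≈ 0#) → ∃ λ y → (x * y) ≈ 1#

-- ±1 entries are encoded by Bool: false ↦ +1, true ↦ -1.

-- Sylvester Hadamard matrix H_{2^k} (H_1 = [1], so H_2 is as in the paper).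
-- remQuot (2 ^ k) i = (i / 2^k , i mod 2^k): the block row / position.
H : (k : ℕ) → Fin (2 ^ k) → Fin (2 ^ k) → Bool
H zero zero zero = false
H (suc k) i j with remQuot {2} (2 ^ k) i | remQuot {2} (2 ^ k) j
... | a , i' | b , j' = (isOne a ∧ isOne b) xor H k i' j'
  where
  isOne : Fin 2 → Bool
  isOne zero = false
  isOne (suc _) = true

-- T' m is the paper's T_{m+1}: (m+1) × 2^m, rows 0..m.
-- T_1 = [1];  T_{m+1} = [ T_m T_m ; 1…1 -1…-1 ].
T' : (m : ℕ) → Fin (suc m) → Fin (2 ^ m) → Bool
T' zero zero zero = false
T' (suc m) i k with toℕ i ℕ.≟ suc m
... | yes _  = isOne (proj₁ (remQuot {2} (2 ^ m) k))
  where
  isOne : Fin 2 → Bool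
  isOne zero = false
  isOne (suc _) = true
... | no ne = T' m (lower₁ i (ne ∘ sym)) (proj₂ (remQuot {2} (2 ^ m) k))

T : (m : ℕ) → Fin m → Fin (2 ^ (m ∸ 1)) → Bool
T (suc m) = T' m

-- Entry of row (i,j) (i < j) of CT_m in column k: (c_k)_i (c_k)_j.
CT : (m : ℕ) → Fin m → Fin m → Fin (2 ^ (m ∸ 1)) → Bool
CT m i j k = T m i k xor T m j k

-- Row r of H_{2^(m-1)} belongs to R_m (the set of rows of CT_m).
InR : (m : ℕ) → Fin (2 ^ (m ∸ 1)) → Set
InR m r = ∃ λ (i : Fin m) → ∃ λ (j : Fin m) →
            (i < j) × (∀ k → H (m ∸ 1) r k ≡ CT m i j k)

InRC : (m : ℕ) → Fin (2 ^ (m ∸ 1)) → Set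
InRC m r = ¬ InR m r

module _ {c ℓ₁ ℓ₂} (F : OrderedField c ℓ₁ ℓ₂) where
  open OrderedField F hiding (zero)

  sgn : Bool → Carrier
  sgn false = 1#
  sgn true  = - 1#

  ∑ : (n : ℕ) → (Fin n → Carrier) → Carrier
  ∑ zero    f = 0#
  ∑ (suc n) f = f zero + ∑ n (f ∘ suc)

  -- M (m × n) is m-Hadamardesque, witnessed by p, κ: column l is p_l c_{κ l}, p_l > 0.
  HadamardesqueWith : (m n : ℕ) → (Fin m → Fin n → Carrier) →
                      (Fin n → Carrier) → (Fin n → Fin (2 ^ (m ∸ 1))) → Set (ℓ₁ ⊔ ℓ₂)
  HadamardesqueWith m n M p κ =
    (∀ l → 0# <F p l) × (∀ i l → M i l ≈ (p l * sgn (T m i (κ l))))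

  CRV : (m n : ℕ) → (Fin n → Carrier) → (Fin n → Fin (2 ^ (m ∸ 1))) →
        Fin (2 ^ (m ∸ 1)) → Carrier
  CRV m n p κ k = ∑ n (λ l → if ⌊ κ l ≟ k ⌋ then p l * p l else 0#)
    where open import Relation.Nullary.Decidable using (⌊_⌋)

  RowsOrthogonal : (m n : ℕ) → (Fin m → Fin n → Carrier) → Set ℓ₁
  RowsOrthogonal m n M = ∀ i j → i ≢ j → ∑ n (λ l → M i l * M j l) ≈ 0#

  -- v lies in the linear span of RC_m: a linear combination of rows of
  -- H_{2^(m-1)} whose coefficients vanish on the rows not in RC_m.
  InSpanRC : (m : ℕ) → (Fin (2 ^ (m ∸ 1)) → Carrier) → Set (c ⊔ ℓ₁)
  InSpanRC m v = ∃ λ (a : Fin (2 ^ (m ∸ 1)) → Carrier) →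
    (∀ r → ¬ InRC m r → a r ≈ 0#) ×
    (∀ k → v k ≈ ∑ (2 ^ (m ∸ 1)) (λ r → a r * sgn (H (m ∸ 1) r k)))

-- Write h r for the ±1 rows of the Sylvester matrix H_{2^(m-1)} and v for the Column
-- Representation Vector. Column l of M contributes p_l² (c_k)_i (c_k)_j to the product of
-- rows i and j, so that product is ⟨v, row (i,j) of CT_m⟩. Rows of T_m are rows of H, and
-- entrywise products of rows of H are rows of H, so row (i,j) of CT_m is some h r with r ∈ R_m.
-- Finally H Hᵀ = N·I with N = 2^(m-1) ≠ 0, hence v = N⁻¹ Σ_r ⟨v, h r⟩ h r is the unique
-- expansion of v in the rows of H: the rows of M are orthogonal iff ⟨v, h r⟩ = 0 for r ∈ R_m,
-- iff the coefficients of v vanish on R_m, i.e. v lies in the span of RC_m.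

module Submission where

open import Defs
open import Level using (Level)
open import Algebra.Bundles using (CommutativeRing; Monoid; Semiring)
open import Data.Nat as ℕ using (ℕ; zero; suc; _^_; _∸_; _≤_)
open import Data.Fin using (Fin; zero; suc; toℕ; combine; quotient; remainder; splitAt; lower₁; _↑ˡ_; _↑ʳ_; _≟_)
open import Data.Fin.Properties using (remQuot-combine; combine-remQuot; suc-injective; <-cmp; <⇒≢)
open import Data.Bool using (Bool; true; false; _xor_; _∧_; if_then_else_)
open import Data.Bool.Properties using (∧-comm; ∧-distribʳ-xor; xor-comm; xor-∧-commutativeRing)
open import Data.Product using (∃; _×_; _,_; proj₁; proj₂)
open import Data.Sum using (inj₁; inj₂)
open import Data.Vec.Functional using (Vector)
open import Function using (_∘_)
open import Function.Bundles using (_⇔_; mk⇔)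
open import Relation.Binary.Definitions using (tri<; tri≈; tri>)
open import Relation.Binary.Structures using (IsStrictTotalOrder)
open import Relation.Binary.PropositionalEquality as ≡ using (_≡_; _≢_)
open import Relation.Nullary using (¬_; yes; no; contradiction)
open import Relation.Nullary.Decidable using (⌊_⌋; decidable-stable)
open import Relation.Nullary.Negation using (Stable)
open import Algebra.Properties.CommutativeSemigroup
  (CommutativeRing.+-commutativeSemigroup xor-∧-commutativeRing) using () renaming (interchange to xor-interchange)

module MonoidSum {a ℓ} (M : Monoid a ℓ) where
  open Monoid M renaming (_∙_ to _+_; ε to 0#; ∙-congˡ to +-congˡ; ∙-congʳ to +-congʳ;
                          identityˡ to +-identityˡ; identityʳ to +-identityʳ; assoc to +-assoc)
  open import Algebra.Properties.Monoid.Sum M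

  sum-single : ∀ {n} (f : Vector Carrier n) i → (∀ j → j ≢ i → f j ≈ 0#) → sum f ≈ f i
  sum-single {suc n} f zero vanish =
    trans (+-congˡ (trans (sum-cong-≋ (λ j → vanish (suc j) λ ())) (sum-replicate-zero n))) (+-identityʳ _)
  sum-single {suc n} f (suc i) vanish = trans (+-congʳ (vanish zero λ ())) (trans (+-identityˡ _)
    (sum-single (f ∘ suc) i (λ j j≢i → vanish (suc j) (j≢i ∘ suc-injective))))

  sum-++ : ∀ m {n} (f : Vector Carrier (m ℕ.+ n)) → sum f ≈ sum (f ∘ (_↑ˡ n)) + sum (f ∘ (m ↑ʳ_))
  sum-++ zero    f = sym (+-identityˡ _)
  sum-++ (suc m) f = trans (+-congˡ (sum-++ m (f ∘ suc))) (sym (+-assoc _ _ _))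

  sum-combine : ∀ m n (f : Vector Carrier (m ℕ.* n)) → sum f ≈ ∑[ i < m ] ∑[ j < n ] f (combine i j)
  sum-combine zero    n f = refl
  sum-combine (suc m) n f = trans (sum-++ n f) (+-congˡ (sum-combine m n (f ∘ (n ↑ʳ_))))

module SemiringSum {c ℓ} (R : Semiring c ℓ) where
  open Semiring R
  open import Algebra.Properties.Semiring.Sum R
  open MonoidSum +-monoid
  open import Relation.Binary.Reasoning.Setoid setoid

  sum-fibres : ∀ {n k} (κ : Fin n → Fin k) (w : Vector Carrier n) (g : Vector Carrier k) →
    ∑[ j < k ] ((∑[ l < n ] (if ⌊ κ l ≟ j ⌋ then w l else 0#)) * g j) ≈ ∑[ l < n ] (w l * g (κ l))
  sum-fibres {n} {k} κ w g = begin
    ∑[ j < k ] ((∑[ l < n ] (if ⌊ κ l ≟ j ⌋ then w l else 0#)) * g j)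
      ≈⟨ sum-cong-≋ (λ j → *-distribʳ-sum (g j) (λ l → if ⌊ κ l ≟ j ⌋ then w l else 0#)) ⟩
    ∑[ j < k ] ∑[ l < n ] ((if ⌊ κ l ≟ j ⌋ then w l else 0#) * g j)
      ≈⟨ ∑-comm (λ j l → (if ⌊ κ l ≟ j ⌋ then w l else 0#) * g j) ⟩
    ∑[ l < n ] ∑[ j < k ] ((if ⌊ κ l ≟ j ⌋ then w l else 0#) * g j)
      ≈⟨ sum-cong-≋ (λ l → sum-single _ (κ l) (off-fibre l)) ⟩
    ∑[ l < n ] ((if ⌊ κ l ≟ κ l ⌋ then w l else 0#) * g (κ l))
      ≈⟨ sum-cong-≋ on-fibre ⟩
    ∑[ l < n ] (w l * g (κ l)) ∎
    where
    off-fibre : ∀ l j → j ≢ κ l → (if ⌊ κ l ≟ j ⌋ then w l else 0#) * g j ≈ 0#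
    off-fibre l j j≢κl with κ l ≟ j
    ... | yes κl≡j = contradiction (≡.sym κl≡j) j≢κl
    ... | no _     = zeroˡ (g j)
    on-fibre : ∀ l → (if ⌊ κ l ≟ κ l ⌋ then w l else 0#) * g (κ l) ≈ w l * g (κ l)
    on-fibre l with κ l ≟ κ l
    ... | yes _   = refl
    ... | no κl≢κl = contradiction ≡.refl κl≢κl

isOne : Fin 2 → Bool
isOne zero    = false
isOne (suc _) = true

join : ∀ k → Fin 2 → Fin (2 ^ k) → Fin (2 ^ suc k)
join k = combine {2} {2 ^ k}

hi : ∀ k → Fin (2 ^ suc k) → Fin 2
hi k = quotient {2} (2 ^ k)

lo : ∀ k → Fin (2 ^ suc k) → Fin (2 ^ k)
lo k = remainder {2} (2 ^ k)

hi-join : ∀ k a r → hi k (join k a r) ≡ a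
hi-join k a r = ≡.cong proj₁ (remQuot-combine {2} {2 ^ k} a r)

lo-join : ∀ k a r → lo k (join k a r) ≡ r
lo-join k a r = ≡.cong proj₂ (remQuot-combine {2} {2 ^ k} a r)

join-hi-lo : ∀ k i → join k (hi k i) (lo k i) ≡ i
join-hi-lo k = combine-remQuot {2} (2 ^ k)

H-suc : ∀ k i j → H (suc k) i j ≡ (isOne (hi k i) ∧ isOne (hi k j)) xor H k (lo k i) (lo k j)
H-suc k i j with splitAt (2 ^ k) i | splitAt (2 ^ k) j
... | inj₁ _ | inj₁ _ = ≡.refl
... | inj₁ _ | inj₂ y with splitAt (2 ^ k) y
...   | inj₁ _ = ≡.refl
H-suc k i j | inj₂ x | inj₁ _ with splitAt (2 ^ k) x
...   | inj₁ _ = ≡.refl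
H-suc k i j | inj₂ x | inj₂ y with splitAt (2 ^ k) x | splitAt (2 ^ k) y
...   | inj₁ _ | inj₁ _ = ≡.refl

H-joinˡ : ∀ k a r j → H (suc k) (join k a r) j ≡ (isOne a ∧ isOne (hi k j)) xor H k r (lo k j)
H-joinˡ k a r j = ≡.trans (H-suc k (join k a r) j)
  (≡.cong₂ (λ b s → (isOne b ∧ isOne (hi k j)) xor H k s (lo k j)) (hi-join k a r) (lo-join k a r))

H-joinʳ : ∀ k i a u → H (suc k) i (join k a u) ≡ (isOne (hi k i) ∧ isOne a) xor H k (lo k i) u
H-joinʳ k i a u = ≡.trans (H-suc k i (join k a u))
  (≡.cong₂ (λ b s → (isOne (hi k i) ∧ isOne b) xor H k (lo k i) s) (hi-join k a u) (lo-join k a u))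

H-sym : ∀ k i j → H k i j ≡ H k j i
H-sym zero    zero zero = ≡.refl
H-sym (suc k) i j = begin
  H (suc k) i j                                                            ≡⟨ H-suc k i j ⟩
  (isOne (hi k i) ∧ isOne (hi k j)) xor H k (lo k i) (lo k j)
    ≡⟨ ≡.cong₂ _xor_ (∧-comm (isOne (hi k i)) (isOne (hi k j))) (H-sym k (lo k i) (lo k j)) ⟩
  (isOne (hi k j) ∧ isOne (hi k i)) xor H k (lo k j) (lo k i)              ≡⟨ H-suc k j i ⟨
  H (suc k) j i                                                            ∎
  where open ≡.≡-Reasoning

zeroIx : ∀ k → Fin (2 ^ k)
zeroIx zero    = zero
zeroIx (suc k) = join k zero (zeroIx k)

H-zeroIx : ∀ k j → H k (zeroIx k) j ≡ false
H-zeroIx zero    zero = ≡.refl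
H-zeroIx (suc k) j = ≡.trans (H-joinˡ k zero (zeroIx k) j) (H-zeroIx k (lo k j))

fromBool : Bool → Fin 2
fromBool false = zero
fromBool true  = suc zero

isOne-fromBool : ∀ b → isOne (fromBool b) ≡ b
isOne-fromBool false = ≡.refl
isOne-fromBool true  = ≡.refl

xorIx : ∀ k → Fin (2 ^ k) → Fin (2 ^ k) → Fin (2 ^ k)
xorIx zero    _ _ = zero
xorIx (suc k) i j = join k (fromBool (isOne (hi k i) xor isOne (hi k j))) (xorIx k (lo k i) (lo k j))

H-xorIx : ∀ k i j t → H k (xorIx k i j) t ≡ H k i t xor H k j t
H-xorIx zero    zero zero zero = ≡.refl
H-xorIx (suc k) i j t = begin
  H (suc k) (xorIx (suc k) i j) t
    ≡⟨ H-joinˡ k (fromBool (a xor b)) (xorIx k (lo k i) (lo k j)) t ⟩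
  (isOne (fromBool (a xor b)) ∧ c) xor H k (xorIx k (lo k i) (lo k j)) (lo k t)
    ≡⟨ ≡.cong₂ (λ x y → (x ∧ c) xor y) (isOne-fromBool (a xor b)) (H-xorIx k (lo k i) (lo k j) (lo k t)) ⟩
  ((a xor b) ∧ c) xor (H k (lo k i) (lo k t) xor H k (lo k j) (lo k t))
    ≡⟨ ≡.cong (_xor (H k (lo k i) (lo k t) xor H k (lo k j) (lo k t))) (∧-distribʳ-xor c a b) ⟩
  ((a ∧ c) xor (b ∧ c)) xor (H k (lo k i) (lo k t) xor H k (lo k j) (lo k t))
    ≡⟨ xor-interchange (a ∧ c) (b ∧ c) (H k (lo k i) (lo k t)) (H k (lo k j) (lo k t)) ⟩
  ((a ∧ c) xor H k (lo k i) (lo k t)) xor ((b ∧ c) xor H k (lo k j) (lo k t))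
    ≡⟨ ≡.cong₂ _xor_ (H-suc k i t) (H-suc k j t) ⟨
  H (suc k) i t xor H (suc k) j t ∎
  where
  open ≡.≡-Reasoning
  a = isOne (hi k i)
  b = isOne (hi k j)
  c = isOne (hi k t)

tRow : ∀ m → Fin (suc m) → Fin (2 ^ m)
tRow zero    zero = zero
tRow (suc m) i with toℕ i ℕ.≟ suc m
... | yes _ = join m (suc zero) (zeroIx m)
... | no ne = join m zero (tRow m (lower₁ i (ne ∘ ≡.sym)))

H-tRow : ∀ m i t → H m (tRow m i) t ≡ T' m i t
H-tRow zero    zero zero = ≡.refl
H-tRow (suc m) i t with toℕ i ℕ.≟ suc m
-- T' reads its last row through its own local copy of isOne, so t has to be split.
... | yes _ rewrite H-joinˡ m (suc zero) (zeroIx m) t | H-zeroIx m (lo m t) with splitAt (2 ^ m) t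
...   | inj₁ _ = ≡.refl
...   | inj₂ x with splitAt (2 ^ m) x
...     | inj₁ _ = ≡.refl
H-tRow (suc m) i t | no ne =
  ≡.trans (H-joinˡ m zero (tRow m (lower₁ i (ne ∘ ≡.sym))) t) (H-tRow m (lower₁ i (ne ∘ ≡.sym)) (lo m t))

ctRow : ∀ m → Fin (suc m) → Fin (suc m) → Fin (2 ^ m)
ctRow m i j = xorIx m (tRow m i) (tRow m j)

H-ctRow : ∀ m i j t → H m (ctRow m i j) t ≡ CT (suc m) i j t
H-ctRow m i j t = ≡.trans (H-xorIx m (tRow m i) (tRow m j) t) (≡.cong₂ _xor_ (H-tRow m i t) (H-tRow m j t))

CT-row-InR : ∀ m (i j : Fin (suc m)) → i ≢ j →
             ∃ λ r → InR (suc m) r × (∀ t → H m r t ≡ CT (suc m) i j t)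
CT-row-InR m i j i≢j with <-cmp i j
... | tri< i<j _ _ = ctRow m i j , (i , j , i<j , H-ctRow m i j) , H-ctRow m i j
... | tri≈ _ i≡j _ = contradiction i≡j i≢j
... | tri> _ _ j<i = ctRow m j i , (j , i , j<i , H-ctRow m j i) ,
                     λ t → ≡.trans (H-ctRow m j i t) (xor-comm (T' m j t) (T' m i t))

module _ {c ℓ₁ ℓ₂} (F : OrderedField c ℓ₁ ℓ₂) where
  open OrderedField F hiding (zero)
  open import Algebra.Properties.Ring ring using (-1*x≈-x)
  open import Algebra.Properties.Group +-group using (⁻¹-involutive)
  open import Algebra.Properties.CommutativeSemigroup *-commutativeSemigroup using () renaming (interchange to *-interchange)
  open import Algebra.Properties.Semiring.Sum semiring
  open import Relation.Binary.Reasoning.Setoid setoid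
  open MonoidSum +-monoid
  open SemiringSum semiring
  module < = IsStrictTotalOrder isStrictTotalOrder

  ∑≡sum : ∀ n (f : Vector Carrier n) → ∑ F n f ≡ sum f
  ∑≡sum zero    f = ≡.refl
  ∑≡sum (suc n) f = ≡.cong (f zero +_) (∑≡sum n (f ∘ suc))

  -1*-1≈1 : - 1# * - 1# ≈ 1#
  -1*-1≈1 = trans (-1*x≈-x (- 1#)) (⁻¹-involutive 1#)

  0<1 : 0# <F 1#
  0<1 with <.compare 0# 1#
  ... | tri< 0<1 _ _ = 0<1
  ... | tri≈ _ 0≈1 _ = contradiction 0≈1 0≉1
  ... | tri> _ _ 1<0 = contradiction (<.trans 0<1′ 1<0) (<.irrefl refl)
    where
    0<-1 : 0# <F (- 1#)
    0<-1 = <.<-respʳ-≈ (+-identityˡ (- 1#)) (<.<-respˡ-≈ (-‿inverseʳ 1#) (+-mono-< (- 1#) 1<0))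
    0<1′ : 0# <F 1#
    0<1′ = <.<-respʳ-≈ -1*-1≈1 (*-pos 0<-1 0<-1)

  +-pos : ∀ {x y} → 0# <F x → 0# <F y → 0# <F (x + y)
  +-pos {x} {y} 0<x 0<y = <.trans 0<x (<.<-respʳ-≈ (+-comm y x) (<.<-respˡ-≈ (+-identityˡ x) (+-mono-< x 0<y)))

  sum-pos : ∀ {n} (f : Vector Carrier n) → (∀ i → 0# <F f i) → Fin n → 0# <F sum f
  sum-pos {suc zero}    f pos _ = <.<-respʳ-≈ (sym (+-identityʳ (f zero))) (pos zero)
  sum-pos {suc (suc n)} f pos _ = +-pos (pos zero) (sum-pos (f ∘ suc) (pos ∘ suc) zero)

  ≈-stable : ∀ x y → Stable (x ≈ y)
  ≈-stable x y = decidable-stable (x <.≟ y)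

  sign : Bool → Carrier
  sign = sgn F

  sign-xor : ∀ x y → sign (x xor y) ≈ sign x * sign y
  sign-xor false y     = sym (*-identityˡ (sign y))
  sign-xor true  false = sym (*-identityʳ (- 1#))
  sign-xor true  true  = sym -1*-1≈1

  sign-square : ∀ x → sign x * sign x ≈ 1#
  sign-square false = *-identityˡ 1#
  sign-square true  = -1*-1≈1

  h : ∀ k → Fin (2 ^ k) → Fin (2 ^ k) → Carrier
  h k r t = sign (H k r t)

  h-sym : ∀ k r t → h k r t ≡ h k t r
  h-sym k r t = ≡.cong sign (H-sym k r t)

  N : ℕ → Carrier
  N k = ∑[ t < 2 ^ k ] 1#

  N-invertible : ∀ k → ∃ λ c → N k * c ≈ 1#
  N-invertible k = inverse (N k) λ N≈0 → <.irrefl (sym N≈0) (sum-pos (λ _ → 1#) (λ _ → 0<1) (zeroIx k))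

  inner : ∀ k → Fin (2 ^ k) → Fin (2 ^ k) → Carrier
  inner k r r′ = ∑[ t < 2 ^ k ] (h k r t * h k r′ t)

  inner-self : ∀ k r → inner k r r ≈ N k
  inner-self k r = sum-cong-≋ (λ t → sign-square (H k r t))

  σ : Fin 2 → Fin 2 → Carrier
  σ a b = ∑[ e < 2 ] (sign (isOne a ∧ isOne e) * sign (isOne b ∧ isOne e))

  1*1+[x+0]≈0 : ∀ {x} → x ≈ - 1# → 1# * 1# + (x + 0#) ≈ 0#
  1*1+[x+0]≈0 {x} x≈-1 = trans (+-cong (*-identityˡ 1#) (trans (+-identityʳ x) x≈-1)) (-‿inverseʳ 1#)

  σ-≢ : ∀ a b → a ≢ b → σ a b ≈ 0#
  σ-≢ zero       zero       a≢b = contradiction ≡.refl a≢b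
  σ-≢ zero       (suc zero) _   = 1*1+[x+0]≈0 (*-identityˡ (- 1#))
  σ-≢ (suc zero) zero       _   = 1*1+[x+0]≈0 (*-identityʳ (- 1#))
  σ-≢ (suc zero) (suc zero) a≢b = contradiction ≡.refl a≢b

  inner-suc : ∀ k r r′ → inner (suc k) r r′ ≈ σ (hi k r) (hi k r′) * inner k (lo k r) (lo k r′)
  inner-suc k r r′ = begin
    inner (suc k) r r′
      ≈⟨ sum-combine 2 (2 ^ k) (λ t → h (suc k) r t * h (suc k) r′ t) ⟩
    ∑[ e < 2 ] ∑[ u < 2 ^ k ] (h (suc k) r (join k e u) * h (suc k) r′ (join k e u))
      ≈⟨ sum-cong-≋ (λ e → sum-cong-≋ (λ u → split e u)) ⟩
    ∑[ e < 2 ] ∑[ u < 2 ^ k ] (τ e * (h k (lo k r) u * h k (lo k r′) u))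
      ≈⟨ sum-cong-≋ (λ e → sym (*-distribˡ-sum (τ e) (λ u → h k (lo k r) u * h k (lo k r′) u))) ⟩
    ∑[ e < 2 ] (τ e * inner k (lo k r) (lo k r′))
      ≈⟨ sym (*-distribʳ-sum (inner k (lo k r) (lo k r′)) τ) ⟩
    σ (hi k r) (hi k r′) * inner k (lo k r) (lo k r′) ∎
    where
    τ : Fin 2 → Carrier
    τ e = sign (isOne (hi k r) ∧ isOne e) * sign (isOne (hi k r′) ∧ isOne e)
    split : ∀ e u → h (suc k) r (join k e u) * h (suc k) r′ (join k e u) ≈ τ e * (h k (lo k r) u * h k (lo k r′) u)
    split e u = begin
      h (suc k) r (join k e u) * h (suc k) r′ (join k e u)
        ≡⟨ ≡.cong₂ (λ x y → sign x * sign y) (H-joinʳ k r e u) (H-joinʳ k r′ e u) ⟩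
      sign (a xor H k (lo k r) u) * sign (b xor H k (lo k r′) u)
        ≈⟨ *-cong (sign-xor a (H k (lo k r) u)) (sign-xor b (H k (lo k r′) u)) ⟩
      (sign a * h k (lo k r) u) * (sign b * h k (lo k r′) u)
        ≈⟨ *-interchange (sign a) (h k (lo k r) u) (sign b) (h k (lo k r′) u) ⟩
      τ e * (h k (lo k r) u * h k (lo k r′) u) ∎
      where
      a = isOne (hi k r) ∧ isOne e
      b = isOne (hi k r′) ∧ isOne e

  inner-≢ : ∀ k r r′ → r ≢ r′ → inner k r r′ ≈ 0#
  inner-≢ zero    zero zero r≢r′ = contradiction ≡.refl r≢r′
  inner-≢ (suc k) r r′ r≢r′ with lo k r ≟ lo k r′
  ... | yes lo≡ = trans (inner-suc k r r′) (trans (*-congʳ (σ-≢ (hi k r) (hi k r′) hi≢)) (zeroˡ _))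
    where
    hi≢ : hi k r ≢ hi k r′
    hi≢ hi≡ = r≢r′ (≡.trans (≡.sym (join-hi-lo k r)) (≡.trans (≡.cong₂ (join k) hi≡ lo≡) (join-hi-lo k r′)))
  ... | no lo≢ = trans (inner-suc k r r′) (trans (*-congˡ (inner-≢ k (lo k r) (lo k r′) lo≢)) (zeroʳ _))

  inner-combination : ∀ k (a : Vector Carrier (2 ^ k)) r₀ →
    ∑[ t < 2 ^ k ] ((∑[ r < 2 ^ k ] (a r * h k r t)) * h k r₀ t) ≈ a r₀ * N k
  inner-combination k a r₀ = begin
    ∑[ t < 2 ^ k ] ((∑[ r < 2 ^ k ] (a r * h k r t)) * h k r₀ t)
      ≈⟨ sum-cong-≋ (λ t → *-distribʳ-sum (h k r₀ t) (λ r → a r * h k r t)) ⟩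
    ∑[ t < 2 ^ k ] ∑[ r < 2 ^ k ] ((a r * h k r t) * h k r₀ t)
      ≈⟨ ∑-comm (λ t r → (a r * h k r t) * h k r₀ t) ⟩
    ∑[ r < 2 ^ k ] ∑[ t < 2 ^ k ] ((a r * h k r t) * h k r₀ t)
      ≈⟨ sum-cong-≋ (λ r → trans (sum-cong-≋ (λ t → *-assoc (a r) (h k r t) (h k r₀ t)))
                                 (sym (*-distribˡ-sum (a r) (λ t → h k r t * h k r₀ t)))) ⟩
    ∑[ r < 2 ^ k ] (a r * inner k r r₀)
      ≈⟨ sum-single (λ r → a r * inner k r r₀) r₀ (λ r r≢r₀ → trans (*-congˡ (inner-≢ k r r₀ r≢r₀)) (zeroʳ (a r))) ⟩
    a r₀ * inner k r₀ r₀
      ≈⟨ *-congˡ (inner-self k r₀) ⟩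
    a r₀ * N k ∎

  module _ (m n : ℕ) (M : Fin (suc m) → Fin n → Carrier) (p : Fin n → Carrier)
           (κ : Fin n → Fin (2 ^ m)) (hadamardesque : HadamardesqueWith F (suc m) n M p κ) where

    v : Vector Carrier (2 ^ m)
    v = CRV F (suc m) n p κ

    rowProduct : ∀ i j → ∑ F n (λ l → M i l * M j l) ≈ ∑[ t < 2 ^ m ] (v t * sign (CT (suc m) i j t))
    rowProduct i j = begin
      ∑ F n (λ l → M i l * M j l)
        ≡⟨ ∑≡sum n (λ l → M i l * M j l) ⟩
      ∑[ l < n ] (M i l * M j l)
        ≈⟨ sum-cong-≋ column ⟩
      ∑[ l < n ] ((p l * p l) * sign (CT (suc m) i j (κ l)))
        ≈⟨ sum-fibres κ (λ l → p l * p l) (λ t → sign (CT (suc m) i j t)) ⟨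
      ∑[ t < 2 ^ m ] ((∑[ l < n ] (if ⌊ κ l ≟ t ⌋ then p l * p l else 0#)) * sign (CT (suc m) i j t))
        ≡⟨ ≡.sym (sum-cong-≗ (λ t → ≡.cong (_* sign (CT (suc m) i j t)) (∑≡sum n (λ l → if ⌊ κ l ≟ t ⌋ then p l * p l else 0#)))) ⟩
      ∑[ t < 2 ^ m ] (v t * sign (CT (suc m) i j t)) ∎
      where
      column : ∀ l → M i l * M j l ≈ (p l * p l) * sign (CT (suc m) i j (κ l))
      column l = begin
        M i l * M j l
          ≈⟨ *-cong (proj₂ hadamardesque i l) (proj₂ hadamardesque j l) ⟩
        (p l * sign (T' m i (κ l))) * (p l * sign (T' m j (κ l)))
          ≈⟨ *-interchange (p l) (sign (T' m i (κ l))) (p l) (sign (T' m j (κ l))) ⟩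
        (p l * p l) * (sign (T' m i (κ l)) * sign (T' m j (κ l)))
          ≈⟨ *-congˡ (sign-xor (T' m i (κ l)) (T' m j (κ l))) ⟨
        (p l * p l) * sign (CT (suc m) i j (κ l)) ∎

    inSpanRC⇒rowsOrthogonal : InSpanRC F (suc m) v → RowsOrthogonal F (suc m) n M
    inSpanRC⇒rowsOrthogonal (a , a-vanishesOffRC , v≈∑ah) i j i≢j with CT-row-InR m i j i≢j
    ... | r₀ , r₀∈R , H-r₀ = begin
      ∑ F n (λ l → M i l * M j l)                                      ≈⟨ rowProduct i j ⟩
      ∑[ t < 2 ^ m ] (v t * sign (CT (suc m) i j t))
        ≈⟨ sum-cong-≋ (λ t → *-cong (trans (v≈∑ah t) (reflexive (∑≡sum (2 ^ m) (λ r → a r * h m r t))))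
                                     (reflexive (≡.cong sign (≡.sym (H-r₀ t))))) ⟩
      ∑[ t < 2 ^ m ] ((∑[ r < 2 ^ m ] (a r * h m r t)) * h m r₀ t)     ≈⟨ inner-combination m a r₀ ⟩
      a r₀ * N m                                                       ≈⟨ *-congʳ (a-vanishesOffRC r₀ (λ r₀∈RC → r₀∈RC r₀∈R)) ⟩
      0# * N m                                                         ≈⟨ zeroˡ (N m) ⟩
      0#                                                               ∎

    rowsOrthogonal⇒inSpanRC : RowsOrthogonal F (suc m) n M → InSpanRC F (suc m) v
    rowsOrthogonal⇒inSpanRC orthogonal = a , a-vanishesOffRC , v≈∑ah
      where
      N⁻¹ : Carrier
      N⁻¹ = proj₁ (N-invertible m)

      ⟨v,h⟩ : Fin (2 ^ m) → Carrier
      ⟨v,h⟩ r = ∑[ t < 2 ^ m ] (v t * h m r t)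

      a : Fin (2 ^ m) → Carrier
      a r = N⁻¹ * ⟨v,h⟩ r

      a-vanishesOnR : ∀ r → InR (suc m) r → a r ≈ 0#
      a-vanishesOnR r (i , j , i<j , H-r) = begin
        N⁻¹ * ⟨v,h⟩ r
          ≡⟨ ≡.cong (N⁻¹ *_) (sum-cong-≗ (λ t → ≡.cong (λ x → v t * sign x) (H-r t))) ⟩
        N⁻¹ * ∑[ t < 2 ^ m ] (v t * sign (CT (suc m) i j t)) ≈⟨ *-congˡ (rowProduct i j) ⟨
        N⁻¹ * ∑ F n (λ l → M i l * M j l)                   ≈⟨ *-congˡ (orthogonal i j (<⇒≢ i<j)) ⟩
        N⁻¹ * 0#                                            ≈⟨ zeroʳ N⁻¹ ⟩
        0#                                                  ∎

      a-vanishesOffRC : ∀ r → ¬ InRC (suc m) r → a r ≈ 0#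
      -- ¬ InRC r is only ¬ ¬ InR r; decidability of ≈ in an ordered field bridges the gap.
      a-vanishesOffRC r r∉RC = ≈-stable (a r) 0# λ a≉0 → r∉RC λ r∈R → a≉0 (a-vanishesOnR r r∈R)

      v≈∑ah : ∀ t → v t ≈ ∑ F (2 ^ m) (λ r → a r * h m r t)
      v≈∑ah t = sym (begin
        ∑ F (2 ^ m) (λ r → a r * h m r t)              ≡⟨ ∑≡sum (2 ^ m) (λ r → a r * h m r t) ⟩
        ∑[ r < 2 ^ m ] ((N⁻¹ * ⟨v,h⟩ r) * h m r t)
          ≈⟨ sum-cong-≋ (λ r → *-assoc N⁻¹ (⟨v,h⟩ r) (h m r t)) ⟩
        ∑[ r < 2 ^ m ] (N⁻¹ * (⟨v,h⟩ r * h m r t))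
          ≈⟨ *-distribˡ-sum N⁻¹ (λ r → ⟨v,h⟩ r * h m r t) ⟨
        N⁻¹ * ∑[ r < 2 ^ m ] (⟨v,h⟩ r * h m r t)
          ≡⟨ ≡.cong (N⁻¹ *_) (sum-cong-≗ λ r → ≡.cong₂ _*_ (sum-cong-≗ λ t′ → ≡.cong (v t′ *_) (h-sym m r t′)) (h-sym m r t)) ⟩
        N⁻¹ * ∑[ r < 2 ^ m ] ((∑[ t′ < 2 ^ m ] (v t′ * h m t′ r)) * h m t r)
          ≈⟨ *-congˡ (inner-combination m v t) ⟩
        N⁻¹ * (v t * N m)  ≈⟨ *-comm N⁻¹ (v t * N m) ⟩
        (v t * N m) * N⁻¹  ≈⟨ *-assoc (v t) (N m) N⁻¹ ⟩
        v t * (N m * N⁻¹)  ≈⟨ *-congˡ (proj₂ (N-invertible m)) ⟩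
        v t * 1#           ≈⟨ *-identityʳ (v t) ⟩
        v t                ∎)

    rowsOrthogonal⇔inSpanRC : RowsOrthogonal F (suc m) n M ⇔ InSpanRC F (suc m) v
    rowsOrthogonal⇔inSpanRC = mk⇔ rowsOrthogonal⇒inSpanRC inSpanRC⇒rowsOrthogonal

mainTheorem7 : ∀ {c ℓ₁ ℓ₂ : Level} (F : OrderedField c ℓ₁ ℓ₂) →
    (m : ℕ) → 2 ≤ m → (n : ℕ) →
    (M : Fin m → Fin n → OrderedField.Carrier F) →
    (p : Fin n → OrderedField.Carrier F) →
    (κ : Fin n → Fin (2 ^ (m ∸ 1))) →
    HadamardesqueWith F m n M p κ →
    RowsOrthogonal F m n M ⇔ InSpanRC F m (CRV F m n p κ)
-- 2 ≤ m only excludes m = 0: the equivalence holds for m = 1 as well.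
mainTheorem7 F zero    ()
mainTheorem7 F (suc m) _ = rowsOrthogonal⇔inSpanRC F m
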